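{- Let $X$ be a graph in the sense described in the context (loops and multiple edges allowed) which is connected, has countable vertex set, has bounded degree and has no vertex of degree one, and fix $x_0\in VX$. Then for every integer $m>2$, \[ N_m(x_0)=c_m(x_0)-(\deg(x_0)-2)\sum_{i=1}^{\lceil m/2\rceil-1}c_{m-2i}(x_0)+\sum_{i=1}^{\lceil m/2\rceil-1} i\,(\Delta_X c_{m-2i})(x_0), \] where $\lceil\cdot\rceil$ is the ceiling function.
   Context: A graph $X$ consists of a vertex set $VX$ and an edge set $EX$ with maps $e\mapsto (o(e),t(e))\in VX\times VX$ and $e\mapsto \bar e$ such that $\bar e\neq e$, $\bar{\bar e}=e$, $o(e)=t(\bar e)$. For $x\in VX$, $E_x=\{e\in EX: o(e)=x\}$ and $\deg(x)=|E_x|$. A path of length $n$ is a sequence of edges $(e_1,\dots,e_n)$ with $t(e_i)=o(e_{i+1})$; $o(c)=o(e_1)$, $t(c)=t(e_n)$; a vertex is a path of length $0$. A path is closed if $o(c)=t(c)$. A path has back-tracking if $e_{i+1}=\bar e_i$ for some $i$; a geodesic is a path without back-tracking. A geodesic loop is a closed geodesic path; a closed geodesic is a geodesic loop with no tail, where $(e_1,\dots,e_n)$ has a tail if $e_n=\bar e_1$. For $x\in VX$ and $m\ge0$, $c_m(x)$ denotes the number of geodesic loops of length $m$ starting at $x$, and $N_m(x_0)$ the number of closed geodesics of length $m$ starting at $x_0$. For $k\ge 0$, $(\Delta_X c_k)(x)=\deg(x)c_k(x)-\sum_{e\in E_x}c_k(t(e))$. -}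

module Defs where

open import Data.Nat as ℕ using (ℕ; zero; suc; _≤_; ⌈_/2⌉; _∸_)
open import Data.Integer as ℤ using (ℤ; _-_; +_)
import Data.Fin as Fin
open import Data.Fin using (Fin; toℕ)
open import Data.Fin.Properties using (toℕ-injective)
open import Data.List using (List; []; _∷_; [_]; map; concatMap; filter; length)
open import Data.List.Relation.Unary.Any using (Any)
open import Data.Product using (Σ; Σ-syntax; _×_; _,_; proj₁)
open import Data.Unit using (⊤; tt)
open import Relation.Nullary using (¬_; Dec; yes; no)
open import Relation.Nullary.Decidable using (_×-dec_; ¬?)
open import Relation.Binary.Definitions using (DecidableEquality)
open import Relation.Binary.PropositionalEquality using (_≡_; _≢_; refl; cong)
open import Function.Definitions using (Injective)

-- Graphs in Serre's sense (loops and multiple edges allowed).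
-- The out-edge set E_x = { e | o e ≡ x } is enumerated bijectively by
-- Fin (deg x) via  edge x : Fin (deg x) → E ; hence deg x = |E_x|.

record Graph : Set₁ where
  field
    V       : Set
    E       : Set
    o t     : E → V
    bar     : E → E
    bar-≢   : ∀ e → bar e ≢ e
    bar-bar : ∀ e → bar (bar e) ≡ e
    o-bar   : ∀ e → o e ≡ t (bar e)
    deg     : V → ℕ
    edge    : (x : V) → Fin (deg x) → E
    edge-o  : ∀ x i → o (edge x i) ≡ x
    edge-inj  : ∀ x i j → edge x i ≡ edge x j → i ≡ j
    edge-surj : ∀ e → Σ[ i ∈ Fin (deg (o e)) ] edge (o e) i ≡ e

module _ (G : Graph) where
  open Graph G

  idx : (e : E) → Fin (deg (o e))
  idx e = proj₁ (edge-surj e)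

  data IsPath : V → List E → V → Set where
    nil  : ∀ {x} → IsPath x [] x
    cons : ∀ {x e p y} → o e ≡ x → IsPath (t e) p y → IsPath x (e ∷ p) y

  Connected : Set
  Connected = ∀ x y → Σ[ p ∈ List E ] IsPath x p y

  Countable : Set
  Countable = Σ[ f ∈ (V → ℕ) ] Injective _≡_ _≡_ f

  BoundedDegree : Set
  BoundedDegree = Σ[ D ∈ ℕ ] (∀ x → deg x ≤ D)

  NoDegreeOne : Set
  NoDegreeOne = ∀ x → deg x ≢ 1

  decV : Countable → DecidableEquality V
  decV (f , inj) x y with f x ℕ.≟ f y
  ... | yes q = yes (inj q)
  ... | no ne = no (λ eq → ne (cong f eq))

  pathsFrom : ℕ → V → List (List E)
  pathsFrom zero    x = [ [] ]
  pathsFrom (suc m) x =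
    concatMap (λ i → map (edge x i ∷_) (pathsFrom m (t (edge x i))))
              (Data.List.allFin (deg x))

  endpoint : V → List E → V
  endpoint x []      = x
  endpoint x (e ∷ p) = endpoint (t e) p

  NoBacktrack : List E → Set
  NoBacktrack []           = ⊤
  NoBacktrack (e ∷ [])     = ⊤
  NoBacktrack (e ∷ f ∷ p)  = (f ≢ bar e) × NoBacktrack (f ∷ p)

  lastE : E → List E → E
  lastE e []      = e
  lastE e (f ∷ p) = lastE f p

  NoTail : List E → Set
  NoTail []      = ⊤
  NoTail (e ∷ p) = lastE e p ≢ bar e

  module Counting (_≟V_ : DecidableEquality V) where

    lemma : ∀ x y (p : x ≡ y) (i : Fin (deg x)) (j : Fin (deg y)) →
            toℕ i ≡ toℕ j → edge x i ≡ edge y j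
    lemma x .x refl i j q = cong (edge x) (toℕ-injective q)

    _≟E_ : DecidableEquality E
    e ≟E f with o e ≟V o f
    ... | no ne = no (λ eq → ne (cong o eq))
    ... | yes p with toℕ (idx e) ℕ.≟ toℕ (idx f)
    ...   | no ne = no (λ eq → ne (cong (λ g → toℕ (idx g)) eq))
    ...   | yes q = yes (Relation.Binary.PropositionalEquality.trans
                      (Relation.Binary.PropositionalEquality.sym (Σ.proj₂ (edge-surj e)))
                      (Relation.Binary.PropositionalEquality.trans
                        (lemma (o e) (o f) p (idx e) (idx f) q)
                        (Σ.proj₂ (edge-surj f))))

    noBacktrack? : (p : List E) → Dec (NoBacktrack p)
    noBacktrack? []          = yes tt
    noBacktrack? (e ∷ [])    = yes tt
    noBacktrack? (e ∷ f ∷ p) = ¬? (f ≟E bar e) ×-dec noBacktrack? (f ∷ p)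

    noTail? : (p : List E) → Dec (NoTail p)
    noTail? []      = yes tt
    noTail? (e ∷ p) = ¬? (lastE e p ≟E bar e)

    GeodLoop : V → List E → Set
    GeodLoop x p = NoBacktrack p × (endpoint x p ≡ x)

    geodLoop? : ∀ x p → Dec (GeodLoop x p)
    geodLoop? x p = noBacktrack? p ×-dec (endpoint x p ≟V x)

    ClosedGeod : V → List E → Set
    ClosedGeod x p = GeodLoop x p × NoTail p

    closedGeod? : ∀ x p → Dec (ClosedGeod x p)
    closedGeod? x p = geodLoop? x p ×-dec noTail? p

    c : ℕ → V → ℕ
    c m x = length (filter (geodLoop? x) (pathsFrom m x))

    N : ℕ → V → ℕ
    N m x = length (filter (closedGeod? x) (pathsFrom m x))

    sumFin : (n : ℕ) → (Fin n → ℤ) → ℤ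
    sumFin zero    f = + 0
    sumFin (suc n) f = f Fin.zero ℤ.+ sumFin n (λ i → f (Fin.suc i))

    Δc : ℕ → V → ℤ
    Δc k x = (+ deg x) ℤ.* (+ c k x) - sumFin (deg x) (λ i → + c k (t (edge x i)))

sum1to : ℕ → (ℕ → ℤ) → ℤ
sum1to zero    f = + 0
sum1to (suc n) f = sum1to n f ℤ.+ f (suc n)

upper : ℕ → ℕ
upper m = ⌈ m /2⌉ ∸ 1

-- A geodesic loop of length j + 2 at x either is a closed geodesic or has a tail: it is e p ē with
-- e an edge out of x and p a geodesic loop at t e that neither starts with ē nor ends with e. The
-- geodesic loops of length j at the ends of the edges out of x number deg(x) c_j - Δc_j, so
-- inclusion–exclusion over the conditions that p starts with ē and that p ends with e counts the
-- tails. The two one-sided counts agree (reverse p), and moving e from the end of p to its front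
-- turns the loops ending with e into the closed walks at x whose rotation is geodesic: the closed
-- geodesics, plus the pairs (w , e) with w a closed walk of length j - 2 at x and ē w e geodesic.
-- These pairs are also what the two-sided count counts. Since e must avoid both the first edge of
-- w and the reverse of its last edge, there are (deg(x) - 1) c_n - N_n of them for n = j - 2 ≥ 1,
-- and none for n = 0. The resulting second-order recurrence for N_j - c_j, started from N_1 = c_1
-- and N_2 = c_2, solves to the formula.

module Submission where

open import Defs
open import Relation.Binary.Definitions using (DecidableEquality)

module PathSums where

  open import Data.Bool using (Bool; true; false; _∧_; not)
  open import Data.Bool.Properties using (∧-identityʳ; ∧-zeroʳ; ∧-assoc; ∧-comm; ∧-commutativeMonoid)
  import Algebra.Solver.CommutativeMonoid ∧-commutativeMonoid as ∧-Solver
  open ∧-Solver using (_⊕_; _⊜_)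
  open import Data.Nat using (ℕ; zero; suc; _+_; _*_; _∸_)
  open import Data.Nat.Properties
    using (+-*-semiring; +-assoc; +-identityʳ; +-cancelʳ-≡; *-identityˡ; *-identityʳ; *-zeroʳ)
  open import Algebra.Properties.Semiring.Sum +-*-semiring
    using (sum-syntax; sum-cong-≗; ∑-distrib-+; ∑-comm; *-distribˡ-sum; sum-replicate-zero)
  open import Data.Nat.Solver using (module +-*-Solver)
  open +-*-Solver using (solve; _:+_; _:=_)
  open import Data.Fin as Fin using (Fin)
  open import Data.Fin.Properties using (suc-injective)
  open import Data.List as List using (List; []; _∷_; [_]; _++_; map; concatMap; filter; length; tabulate)
  open import Data.Product using (_×_; _,_; proj₂)
  open import Function using (_∘_; mk⇔)
  open import Relation.Nullary using (Dec; yes; no; does; contradiction)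
  open import Relation.Nullary.Decidable using (dec-true; dec-false; does-⇔)
  open import Relation.Binary.PropositionalEquality hiding ([_])
  open ≡-Reasoning

  𝟙 : Bool → ℕ
  𝟙 true  = 1
  𝟙 false = 0

  𝟙-*-𝟙 : ∀ a b → 𝟙 a * 𝟙 b ≡ 𝟙 (b ∧ a)
  𝟙-*-𝟙 true  true  = refl
  𝟙-*-𝟙 true  false = refl
  𝟙-*-𝟙 false true  = refl
  𝟙-*-𝟙 false false = refl

  𝟙-split : ∀ a b → 𝟙 a ≡ 𝟙 (a ∧ not b) + 𝟙 b * 𝟙 a
  𝟙-split true  true  = refl
  𝟙-split true  false = refl
  𝟙-split false true  = refl
  𝟙-split false false = refl

  𝟙-rotate : ∀ s g n → 𝟙 s * 𝟙 (g ∧ n) ≡ 𝟙 n * 𝟙 (s ∧ g)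
  𝟙-rotate true  true  true  = refl
  𝟙-rotate true  true  false = refl
  𝟙-rotate true  false true  = refl
  𝟙-rotate true  false false = refl
  𝟙-rotate false true  true  = refl
  𝟙-rotate false true  false = refl
  𝟙-rotate false false true  = refl
  𝟙-rotate false false false = refl

  𝟙-inclusion-exclusion₂ : ∀ a b → 𝟙 (not a ∧ not b) + 𝟙 a + 𝟙 b ≡ 1 + 𝟙 a * 𝟙 b
  𝟙-inclusion-exclusion₂ true  true  = refl
  𝟙-inclusion-exclusion₂ true  false = refl
  𝟙-inclusion-exclusion₂ false true  = refl
  𝟙-inclusion-exclusion₂ false false = refl

  𝟙-inclusion-exclusion : ∀ g n f z →
    𝟙 (g ∧ n) + 𝟙 f * (𝟙 z * 𝟙 (g ∧ n)) ≡
    𝟙 n * 𝟙 (not f ∧ (g ∧ not z)) + 𝟙 f * 𝟙 (g ∧ n) + 𝟙 z * 𝟙 (g ∧ n)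
  𝟙-inclusion-exclusion true  true  true  true  = refl
  𝟙-inclusion-exclusion true  true  true  false = refl
  𝟙-inclusion-exclusion true  true  false true  = refl
  𝟙-inclusion-exclusion true  true  false false = refl
  𝟙-inclusion-exclusion true  false true  true  = refl
  𝟙-inclusion-exclusion true  false true  false = refl
  𝟙-inclusion-exclusion true  false false true  = refl
  𝟙-inclusion-exclusion true  false false false = refl
  𝟙-inclusion-exclusion false true  true  true  = refl
  𝟙-inclusion-exclusion false true  true  false = refl
  𝟙-inclusion-exclusion false true  false true  = refl
  𝟙-inclusion-exclusion false true  false false = refl
  𝟙-inclusion-exclusion false false true  true  = refl
  𝟙-inclusion-exclusion false false true  false = refl
  𝟙-inclusion-exclusion false false false true  = refl
  𝟙-inclusion-exclusion false false false false = refl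

  ∑-one : ∀ n → ∑[ i < n ] 1 ≡ n
  ∑-one zero    = refl
  ∑-one (suc n) = cong suc (∑-one n)

  ∑-δ : ∀ n (j : Fin n) (f : Fin n → ℕ) → ∑[ i < n ] (𝟙 (does (i Fin.≟ j)) * f i) ≡ f j
  ∑-δ (suc n) Fin.zero    f = begin
    f Fin.zero + 0 + ∑[ i < n ] 0 ≡⟨ cong (f Fin.zero + 0 +_) (sum-replicate-zero n) ⟩
    f Fin.zero + 0 + 0            ≡⟨ trans (+-identityʳ _) (+-identityʳ _) ⟩
    f Fin.zero                    ∎
  ∑-δ (suc n) (Fin.suc j) f = begin
    ∑[ i < n ] (𝟙 (does (Fin.suc i Fin.≟ Fin.suc j)) * f (Fin.suc i))
      ≡⟨ sum-cong-≗ {n} (λ i → cong (λ b → 𝟙 b * f (Fin.suc i)) (does-suc i)) ⟩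
    ∑[ i < n ] (𝟙 (does (i Fin.≟ j)) * f (Fin.suc i))
      ≡⟨ ∑-δ n j (f ∘ Fin.suc) ⟩
    f (Fin.suc j) ∎
    where
    does-suc : ∀ i → does (Fin.suc i Fin.≟ Fin.suc j) ≡ does (i Fin.≟ j)
    does-suc i = does-⇔ (mk⇔ suc-injective (cong Fin.suc)) (Fin.suc i Fin.≟ Fin.suc j) (i Fin.≟ j)

  ∑ᴸ : {A : Set} → (A → ℕ) → List A → ℕ
  ∑ᴸ w []       = 0
  ∑ᴸ w (a ∷ as) = w a + ∑ᴸ w as

  ∑ᴸ-++ : {A : Set} (w : A → ℕ) (as bs : List A) → ∑ᴸ w (as ++ bs) ≡ ∑ᴸ w as + ∑ᴸ w bs
  ∑ᴸ-++ w []       bs = refl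
  ∑ᴸ-++ w (a ∷ as) bs = trans (cong (w a +_) (∑ᴸ-++ w as bs)) (sym (+-assoc (w a) _ _))

  ∑ᴸ-map : {A B : Set} (w : B → ℕ) (f : A → B) (as : List A) → ∑ᴸ w (map f as) ≡ ∑ᴸ (w ∘ f) as
  ∑ᴸ-map w f []       = refl
  ∑ᴸ-map w f (a ∷ as) = cong (w (f a) +_) (∑ᴸ-map w f as)

  ∑ᴸ-concatMap : {A B : Set} (w : B → ℕ) (f : A → List B) (as : List A) →
                 ∑ᴸ w (concatMap f as) ≡ ∑ᴸ (∑ᴸ w ∘ f) as
  ∑ᴸ-concatMap w f []       = refl
  ∑ᴸ-concatMap w f (a ∷ as) =
    trans (∑ᴸ-++ w (f a) (concatMap f as)) (cong (∑ᴸ w (f a) +_) (∑ᴸ-concatMap w f as))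

  ∑ᴸ-tabulate : ∀ n {A : Set} (w : A → ℕ) (f : Fin n → A) → ∑ᴸ w (tabulate f) ≡ ∑[ i < n ] w (f i)
  ∑ᴸ-tabulate zero    w f = refl
  ∑ᴸ-tabulate (suc n) w f = cong (w (f Fin.zero) +_) (∑ᴸ-tabulate n w (f ∘ Fin.suc))

  length-filter≡∑ᴸ : {A : Set} {P : A → Set} (P? : ∀ a → Dec (P a)) (as : List A) →
                     length (filter P? as) ≡ ∑ᴸ (𝟙 ∘ does ∘ P?) as
  length-filter≡∑ᴸ P? []       = refl
  length-filter≡∑ᴸ P? (a ∷ as) with does (P? a)
  ... | true  = cong suc (length-filter≡∑ᴸ P? as)
  ... | false = length-filter≡∑ᴸ P? as

  module OnGraph (G : Graph) (_≟V_ : DecidableEquality (Graph.V G)) where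
    open Graph G
    open Counting G _≟V_

    end : V → List E → V
    end = endpoint G

    last : E → List E → E
    last = lastE G

    _=ᴱ_ : E → E → Bool
    a =ᴱ b = does (a ≟E b)

    _=ⱽ_ : V → V → Bool
    u =ⱽ v = does (u ≟V v)

    geodesic : List E → Bool
    geodesic p = does (noBacktrack? p)

    loop : V → List E → Bool
    loop y p = does (geodLoop? y p)

    closed : V → List E → Bool
    closed y p = does (closedGeod? y p)

    startsWith : E → List E → Bool
    startsWith a []      = false
    startsWith a (f ∷ _) = f =ᴱ a

    endsWith : E → List E → Bool
    endsWith a []      = false
    endsWith a (f ∷ q) = last f q =ᴱ a

    origin-bar : ∀ e → o (bar e) ≡ t e
    origin-bar e = trans (o-bar (bar e)) (cong t (bar-bar e))

    target-bar : ∀ e → t (bar e) ≡ o e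
    target-bar e = sym (o-bar e)

    =ⱽ-refl : ∀ v → (v =ⱽ v) ≡ true
    =ⱽ-refl v = dec-true (v ≟V v) refl

    =ⱽ-sym : ∀ u v → (u =ⱽ v) ≡ (v =ⱽ u)
    =ⱽ-sym u v = does-⇔ (mk⇔ sym sym) (u ≟V v) (v ≟V u)

    =ᴱ-sym : ∀ a b → (a =ᴱ b) ≡ (b =ᴱ a)
    =ᴱ-sym a b = does-⇔ (mk⇔ sym sym) (a ≟E b) (b ≟E a)

    bar-=ᴱ-bar : ∀ a b → (bar a =ᴱ bar b) ≡ (a =ᴱ b)
    bar-=ᴱ-bar a b = does-⇔ (mk⇔ (λ q → trans (sym (bar-bar a)) (trans (cong bar q) (bar-bar b))) (cong bar))
                            (bar a ≟E bar b) (a ≟E b)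

    =ᴱ-bar : ∀ a b → (a =ᴱ bar b) ≡ (b =ᴱ bar a)
    =ᴱ-bar a b = does-⇔ (mk⇔ (λ q → trans (sym (bar-bar b)) (cong bar (sym q)))
                             (λ q → trans (sym (bar-bar a)) (cong bar (sym q))))
                        (a ≟E bar b) (b ≟E bar a)

    bar-=ᴱ-self : ∀ e → (bar e =ᴱ e) ≡ false
    bar-=ᴱ-self e = dec-false (bar e ≟E e) (bar-≢ e)

    =ᴱ-bar-self : ∀ e → (e =ᴱ bar e) ≡ false
    =ᴱ-bar-self e = dec-false (e ≟E bar e) (λ q → bar-≢ e (sym q))

    end-snoc : ∀ y p g → end y (p ++ [ g ]) ≡ t g
    end-snoc y []      g = refl
    end-snoc y (e ∷ p) g = end-snoc (t e) p g

    end≡t-last : ∀ e p → end (t e) p ≡ t (last e p)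
    end≡t-last e []      = refl
    end≡t-last e (f ∷ p) = end≡t-last f p

    last-snoc : ∀ e p g → last e (p ++ [ g ]) ≡ g
    last-snoc e []      g = refl
    last-snoc e (f ∷ p) g = last-snoc f p g

    endsWith-snoc : ∀ a p g → endsWith a (p ++ [ g ]) ≡ (g =ᴱ a)
    endsWith-snoc a []      g = refl
    endsWith-snoc a (e ∷ p) g = cong (_=ᴱ a) (last-snoc e p g)

    geodesic-∷ : ∀ a p → geodesic (a ∷ p) ≡ not (startsWith (bar a) p) ∧ geodesic p
    geodesic-∷ a []      = refl
    geodesic-∷ a (f ∷ p) = refl

    geodesic-snoc : ∀ p g → geodesic (p ++ [ g ]) ≡ geodesic p ∧ not (endsWith (bar g) p)
    geodesic-snoc []          g = refl
    geodesic-snoc (e ∷ [])    g = trans (∧-identityʳ _) (cong not (=ᴱ-bar g e))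
    geodesic-snoc (e ∷ f ∷ q) g = trans (cong (not (f =ᴱ bar e) ∧_) (geodesic-snoc (f ∷ q) g))
                                        (sym (∧-assoc (not (f =ᴱ bar e)) _ _))

    loop-snoc : ∀ y p g → t g ≡ y → loop y (p ++ [ g ]) ≡ geodesic (p ++ [ g ])
    loop-snoc y p g tg≡y = begin
      geodesic (p ++ [ g ]) ∧ (end y (p ++ [ g ]) =ⱽ y)
        ≡⟨ cong (λ v → geodesic (p ++ [ g ]) ∧ (v =ⱽ y)) (trans (end-snoc y p g) tg≡y) ⟩
      geodesic (p ++ [ g ]) ∧ (y =ⱽ y)
        ≡⟨ trans (cong (geodesic (p ++ [ g ]) ∧_) (=ⱽ-refl y)) (∧-identityʳ _) ⟩
      geodesic (p ++ [ g ]) ∎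

    rotate : List E → List E
    rotate []      = []
    rotate (e ∷ q) = q ++ [ e ]

    reverseᴱ : List E → List E
    reverseᴱ []      = []
    reverseᴱ (e ∷ p) = reverseᴱ p ++ [ bar e ]

    reverseᴱ-snoc : ∀ p g → reverseᴱ (p ++ [ g ]) ≡ bar g ∷ reverseᴱ p
    reverseᴱ-snoc []      g = refl
    reverseᴱ-snoc (e ∷ p) g = cong (_++ [ bar e ]) (reverseᴱ-snoc p g)

    reverseᴱ-involutive : ∀ p → reverseᴱ (reverseᴱ p) ≡ p
    reverseᴱ-involutive []      = refl
    reverseᴱ-involutive (e ∷ p) =
      trans (reverseᴱ-snoc (reverseᴱ p) (bar e)) (cong₂ _∷_ (bar-bar e) (reverseᴱ-involutive p))

    endsWith-reverseᴱ : ∀ a p → endsWith (bar a) (reverseᴱ p) ≡ startsWith a p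
    endsWith-reverseᴱ a []      = refl
    endsWith-reverseᴱ a (f ∷ p) = trans (endsWith-snoc (bar a) (reverseᴱ p) (bar f)) (bar-=ᴱ-bar f a)

    startsWith-reverseᴱ : ∀ a p → startsWith a (reverseᴱ p) ≡ endsWith (bar a) p
    startsWith-reverseᴱ a p =
      trans (sym (endsWith-reverseᴱ a (reverseᴱ p))) (cong (endsWith (bar a)) (reverseᴱ-involutive p))

    geodesic-reverseᴱ : ∀ p → geodesic (reverseᴱ p) ≡ geodesic p
    geodesic-reverseᴱ []      = refl
    geodesic-reverseᴱ (e ∷ p) = begin
      geodesic (reverseᴱ p ++ [ bar e ])
        ≡⟨ geodesic-snoc (reverseᴱ p) (bar e) ⟩
      geodesic (reverseᴱ p) ∧ not (endsWith (bar (bar e)) (reverseᴱ p))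
        ≡⟨ cong₂ (λ g s → g ∧ not s) (geodesic-reverseᴱ p) (endsWith-reverseᴱ (bar e) p) ⟩
      geodesic p ∧ not (startsWith (bar e) p)
        ≡⟨ ∧-comm (geodesic p) _ ⟩
      not (startsWith (bar e) p) ∧ geodesic p
        ≡⟨ sym (geodesic-∷ e p) ⟩
      geodesic (e ∷ p) ∎

    ∑-edge-δ : ∀ y a (H : E → ℕ) →
      ∑[ j < deg y ] (𝟙 (edge y j =ᴱ a) * H (edge y j)) ≡ 𝟙 (o a =ⱽ y) * H a
    ∑-edge-δ y a H with o a ≟V y
    ... | yes refl = begin
      ∑[ j < deg (o a) ] (𝟙 (edge (o a) j =ᴱ a) * H (edge (o a) j))
        ≡⟨ sum-cong-≗ {deg (o a)} (λ j → cong (λ b → 𝟙 b * H (edge (o a) j)) (edge≡a⇔ j)) ⟩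
      ∑[ j < deg (o a) ] (𝟙 (does (j Fin.≟ idx G a)) * H (edge (o a) j))
        ≡⟨ ∑-δ (deg (o a)) (idx G a) (H ∘ edge (o a)) ⟩
      H (edge (o a) (idx G a))
        ≡⟨ cong H (proj₂ (edge-surj a)) ⟩
      H a
        ≡⟨ sym (+-identityʳ (H a)) ⟩
      1 * H a ∎
      where
      edge≡a⇔ : ∀ j → (edge (o a) j =ᴱ a) ≡ does (j Fin.≟ idx G a)
      edge≡a⇔ j = does-⇔ (mk⇔ (λ q → edge-inj (o a) j (idx G a) (trans q (sym (proj₂ (edge-surj a)))))
                                (λ q → trans (cong (edge (o a)) q) (proj₂ (edge-surj a))))
                          (edge (o a) j ≟E a) (j Fin.≟ idx G a)
    ... | no oa≢y = begin
      ∑[ j < deg y ] (𝟙 (edge y j =ᴱ a) * H (edge y j))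
        ≡⟨ sum-cong-≗ {deg y} (λ j → cong (λ b → 𝟙 b * H (edge y j))
             (dec-false (edge y j ≟E a) (λ q → oa≢y (trans (cong o (sym q)) (edge-o y j))))) ⟩
      ∑[ j < deg y ] 0
        ≡⟨ sum-replicate-zero (deg y) ⟩
      0 ∎

    ∑-edge-reverse : ∀ x y (F : E → ℕ) →
      ∑[ i < deg x ] (𝟙 (t (edge x i) =ⱽ y) * F (edge x i)) ≡
      ∑[ j < deg y ] (𝟙 (t (edge y j) =ⱽ x) * F (bar (edge y j)))
    ∑-edge-reverse x y F = begin
      ∑[ i < deg x ] (𝟙 (t (e i) =ⱽ y) * F (e i))
        ≡⟨ sum-cong-≗ {deg x} (λ i → sym (trans (∑-edge-δ y (bar (e i)) (F ∘ bar))
             (cong₂ (λ v a → 𝟙 (v =ⱽ y) * F a) (origin-bar (e i)) (bar-bar (e i))))) ⟩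
      ∑[ i < deg x ] ∑[ j < deg y ] (𝟙 (g j =ᴱ bar (e i)) * F (bar (g j)))
        ≡⟨ ∑-comm {deg x} {deg y} _ ⟩
      ∑[ j < deg y ] ∑[ i < deg x ] (𝟙 (g j =ᴱ bar (e i)) * F (bar (g j)))
        ≡⟨ sum-cong-≗ {deg y} (λ j → trans
             (sum-cong-≗ {deg x} (λ i → cong (λ b → 𝟙 b * F (bar (g j))) (=ᴱ-bar (g j) (e i))))
             (trans (∑-edge-δ x (bar (g j)) (λ _ → F (bar (g j))))
                    (cong (λ v → 𝟙 (v =ⱽ x) * F (bar (g j))) (origin-bar (g j))))) ⟩
      ∑[ j < deg y ] (𝟙 (t (g j) =ⱽ x) * F (bar (g j))) ∎
      where
      e = edge x
      g = edge y

    ∑-avoiding-two : ∀ y a b → o a ≡ y → o b ≡ y →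
      ∑[ i < deg y ] 𝟙 (not (edge y i =ᴱ a) ∧ not (edge y i =ᴱ b)) + 𝟙 (not (a =ᴱ b)) + 1 ≡ deg y
    ∑-avoiding-two y a b oa≡y ob≡y = finish (a =ᴱ b) counted
      where
      A B : Fin (deg y) → Bool
      A i = edge y i =ᴱ a
      B i = edge y i =ᴱ b

      avoiding : ℕ
      avoiding = ∑[ i < deg y ] 𝟙 (not (A i) ∧ not (B i))

      ∑-hits : ∀ c → o c ≡ y → ∑[ i < deg y ] 𝟙 (edge y i =ᴱ c) ≡ 1
      ∑-hits c oc≡y = begin
        ∑[ i < deg y ] 𝟙 (edge y i =ᴱ c)       ≡⟨ sum-cong-≗ {deg y} (λ i → sym (*-identityʳ _)) ⟩
        ∑[ i < deg y ] (𝟙 (edge y i =ᴱ c) * 1) ≡⟨ ∑-edge-δ y c (λ _ → 1) ⟩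
        𝟙 (o c =ⱽ y) * 1                        ≡⟨ cong (λ β → 𝟙 β * 1) (dec-true (o c ≟V y) oc≡y) ⟩
        1                                       ∎

      counted : avoiding + 1 + 1 ≡ deg y + 𝟙 (a =ᴱ b)
      counted = begin
        avoiding + 1 + 1
          ≡⟨ cong₂ (λ u v → avoiding + u + v) (sym (∑-hits a oa≡y)) (sym (∑-hits b ob≡y)) ⟩
        avoiding + ∑[ i < deg y ] 𝟙 (A i) + ∑[ i < deg y ] 𝟙 (B i)
          ≡⟨ cong (_+ ∑[ i < deg y ] 𝟙 (B i)) (sym (∑-distrib-+ {deg y} _ (𝟙 ∘ A))) ⟩
        ∑[ i < deg y ] (𝟙 (not (A i) ∧ not (B i)) + 𝟙 (A i)) + ∑[ i < deg y ] 𝟙 (B i)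
          ≡⟨ sym (∑-distrib-+ {deg y} _ (𝟙 ∘ B)) ⟩
        ∑[ i < deg y ] (𝟙 (not (A i) ∧ not (B i)) + 𝟙 (A i) + 𝟙 (B i))
          ≡⟨ sum-cong-≗ {deg y} (λ i → 𝟙-inclusion-exclusion₂ (A i) (B i)) ⟩
        ∑[ i < deg y ] (1 + 𝟙 (A i) * 𝟙 (B i))
          ≡⟨ ∑-distrib-+ {deg y} _ _ ⟩
        ∑[ i < deg y ] 1 + ∑[ i < deg y ] (𝟙 (A i) * 𝟙 (B i))
          ≡⟨ cong₂ _+_ (∑-one (deg y)) (∑-edge-δ y a (λ g → 𝟙 (g =ᴱ b))) ⟩
        deg y + 𝟙 (o a =ⱽ y) * 𝟙 (a =ᴱ b)
          ≡⟨ cong (λ β → deg y + 𝟙 β * 𝟙 (a =ᴱ b)) (dec-true (o a ≟V y) oa≡y) ⟩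
        deg y + 1 * 𝟙 (a =ᴱ b)
          ≡⟨ cong (deg y +_) (*-identityˡ _) ⟩
        deg y + 𝟙 (a =ᴱ b) ∎

      finish : ∀ q → avoiding + 1 + 1 ≡ deg y + 𝟙 q → avoiding + 𝟙 (not q) + 1 ≡ deg y
      finish true  h = trans (cong (_+ 1) (+-identityʳ avoiding)) (+-cancelʳ-≡ 1 (avoiding + 1) (deg y) h)
      finish false h = trans h (+-identityʳ (deg y))

    Σpaths : ℕ → V → (List E → ℕ) → ℕ
    Σpaths zero    y w = w []
    Σpaths (suc n) y w = ∑[ i < deg y ] Σpaths n (t (edge y i)) (w ∘ (edge y i ∷_))

    Path : ℕ → V → List E → Set
    Path n y p = length p ≡ n × IsPath G y p (end y p)

    Σpaths-cong : ∀ n y {w₁ w₂ : List E → ℕ} →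
                  (∀ p → Path n y p → w₁ p ≡ w₂ p) → Σpaths n y w₁ ≡ Σpaths n y w₂
    Σpaths-cong zero    y h = h [] (refl , nil)
    Σpaths-cong (suc n) y h = sum-cong-≗ {deg y} λ i →
      Σpaths-cong n _ (λ p (len , path) → h _ (cong suc len , cons (edge-o y i) path))

    Σpaths-ext : ∀ n y {w₁ w₂ : List E → ℕ} →
                 (∀ p → w₁ p ≡ w₂ p) → Σpaths n y w₁ ≡ Σpaths n y w₂
    Σpaths-ext n y h = Σpaths-cong n y (λ p _ → h p)

    Σpaths-+ : ∀ n y (w₁ w₂ : List E → ℕ) →
               Σpaths n y (λ p → w₁ p + w₂ p) ≡ Σpaths n y w₁ + Σpaths n y w₂
    Σpaths-+ zero    y w₁ w₂ = refl
    Σpaths-+ (suc n) y w₁ w₂ = trans (sum-cong-≗ {deg y} (λ i → Σpaths-+ n _ _ _)) (∑-distrib-+ {deg y} _ _)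

    Σpaths-* : ∀ n y a (w : List E → ℕ) → Σpaths n y (λ p → a * w p) ≡ a * Σpaths n y w
    Σpaths-* zero    y a w = refl
    Σpaths-* (suc n) y a w = trans (sum-cong-≗ {deg y} (λ i → Σpaths-* n _ a _))
                                   (sym (*-distribˡ-sum a (λ i → Σpaths n (t (edge y i)) (w ∘ (edge y i ∷_)))))

    Σpaths-∑ : ∀ n y m (F : Fin m → List E → ℕ) →
               Σpaths n y (λ p → ∑[ j < m ] F j p) ≡ ∑[ j < m ] Σpaths n y (F j)
    Σpaths-∑ zero    y m F = refl
    Σpaths-∑ (suc n) y m F = trans (sum-cong-≗ {deg y} (λ i → Σpaths-∑ n _ m _)) (∑-comm {deg y} {m} _)

    Σpaths-snoc : ∀ n y (w : List E → ℕ) →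
      Σpaths (suc n) y w ≡ Σpaths n y (λ p → ∑[ j < deg (end y p) ] w (p ++ [ edge (end y p) j ]))
    Σpaths-snoc zero    y w = refl
    Σpaths-snoc (suc n) y w = sum-cong-≗ {deg y} (λ i → Σpaths-snoc n _ (w ∘ (edge y i ∷_)))

    ∑ᴸ-pathsFrom : ∀ n y (w : List E → ℕ) → ∑ᴸ w (pathsFrom G n y) ≡ Σpaths n y w
    ∑ᴸ-pathsFrom zero    y w = +-identityʳ _
    ∑ᴸ-pathsFrom (suc n) y w = begin
      ∑ᴸ w (concatMap extend (List.allFin (deg y)))
        ≡⟨ ∑ᴸ-concatMap w extend (List.allFin (deg y)) ⟩
      ∑ᴸ (∑ᴸ w ∘ extend) (List.allFin (deg y))
        ≡⟨ ∑ᴸ-tabulate (deg y) (∑ᴸ w ∘ extend) (λ i → i) ⟩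
      ∑[ i < deg y ] ∑ᴸ w (extend i)
        ≡⟨ sum-cong-≗ {deg y} (λ i →
             trans (∑ᴸ-map w (edge y i ∷_) (pathsFrom G n (t (edge y i)))) (∑ᴸ-pathsFrom n _ _)) ⟩
      Σpaths (suc n) y w ∎
      where
      extend : Fin (deg y) → List (List E)
      extend i = map (edge y i ∷_) (pathsFrom G n (t (edge y i)))

    c≡Σpaths : ∀ n y → c n y ≡ Σpaths n y (𝟙 ∘ loop y)
    c≡Σpaths n y = trans (length-filter≡∑ᴸ (geodLoop? y) (pathsFrom G n y)) (∑ᴸ-pathsFrom n y _)

    N≡Σpaths : ∀ n y → N n y ≡ Σpaths n y (𝟙 ∘ closed y)
    N≡Σpaths n y = trans (length-filter≡∑ᴸ (closedGeod? y) (pathsFrom G n y)) (∑ᴸ-pathsFrom n y _)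

    Σpaths-first : ∀ n y a (w : List E → ℕ) → o a ≡ y →
      Σpaths (suc n) y (λ p → 𝟙 (startsWith a p) * w p) ≡ Σpaths n (t a) (λ q → w (a ∷ q))
    Σpaths-first n y a w oa≡y = begin
      ∑[ j < deg y ] Σpaths n (t (g j)) (λ q → 𝟙 (g j =ᴱ a) * w (g j ∷ q))
        ≡⟨ sum-cong-≗ {deg y} (λ j → Σpaths-* n _ (𝟙 (g j =ᴱ a)) (w ∘ (g j ∷_))) ⟩
      ∑[ j < deg y ] (𝟙 (g j =ᴱ a) * Σpaths n (t (g j)) (w ∘ (g j ∷_)))
        ≡⟨ ∑-edge-δ y a (λ h → Σpaths n (t h) (w ∘ (h ∷_))) ⟩
      𝟙 (o a =ⱽ y) * Σpaths n (t a) (w ∘ (a ∷_))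
        ≡⟨ cong (λ b → 𝟙 b * Σpaths n (t a) (w ∘ (a ∷_))) (dec-true (o a ≟V y) oa≡y) ⟩
      1 * Σpaths n (t a) (w ∘ (a ∷_))
        ≡⟨ *-identityˡ _ ⟩
      Σpaths n (t a) (w ∘ (a ∷_)) ∎
      where
      g = edge y

    Σpaths-last : ∀ n y a (w : List E → ℕ) →
      Σpaths (suc n) y (λ p → 𝟙 (endsWith a p) * w p) ≡ Σpaths n y (λ q → 𝟙 (o a =ⱽ end y q) * w (q ++ [ a ]))
    Σpaths-last n y a w = trans (Σpaths-snoc n y (λ p → 𝟙 (endsWith a p) * w p)) (Σpaths-ext n y λ q →
      let g = edge (end y q) in begin
      ∑[ j < deg (end y q) ] (𝟙 (endsWith a (q ++ [ g j ])) * w (q ++ [ g j ]))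
        ≡⟨ sum-cong-≗ {deg (end y q)} (λ j → cong (λ b → 𝟙 b * w (q ++ [ g j ])) (endsWith-snoc a q (g j))) ⟩
      ∑[ j < deg (end y q) ] (𝟙 (g j =ᴱ a) * w (q ++ [ g j ]))
        ≡⟨ ∑-edge-δ (end y q) a (λ h → w (q ++ [ h ])) ⟩
      𝟙 (o a =ⱽ end y q) * w (q ++ [ a ]) ∎)

    Σpaths-reverse : ∀ n y z (w : List E → ℕ) →
      Σpaths n y (λ p → 𝟙 (end y p =ⱽ z) * w p) ≡ Σpaths n z (λ r → 𝟙 (end z r =ⱽ y) * w (reverseᴱ r))
    Σpaths-reverse zero    y z w = cong (λ b → 𝟙 b * w []) (=ⱽ-sym y z)
    Σpaths-reverse (suc n) y z w = begin
      ∑[ i < deg y ] Σpaths n (t (e i)) (λ p → 𝟙 (end (t (e i)) p =ⱽ z) * w (e i ∷ p))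
        ≡⟨ sum-cong-≗ {deg y} (λ i → Σpaths-reverse n (t (e i)) z (w ∘ (e i ∷_))) ⟩
      ∑[ i < deg y ] Σpaths n z (λ r → 𝟙 (end z r =ⱽ t (e i)) * w (e i ∷ reverseᴱ r))
        ≡⟨ sym (Σpaths-∑ n z (deg y) _) ⟩
      Σpaths n z (λ r → ∑[ i < deg y ] (𝟙 (end z r =ⱽ t (e i)) * w (e i ∷ reverseᴱ r)))
        ≡⟨ Σpaths-ext n z last-edge-reversed ⟩
      Σpaths n z (λ r → ∑[ j < deg (end z r) ] W (r ++ [ edge (end z r) j ]))
        ≡⟨ sym (Σpaths-snoc n z W) ⟩
      Σpaths (suc n) z W ∎
      where
      e = edge y

      W : List E → ℕ
      W r = 𝟙 (end z r =ⱽ y) * w (reverseᴱ r)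

      last-edge-reversed : ∀ r → ∑[ i < deg y ] (𝟙 (end z r =ⱽ t (e i)) * w (e i ∷ reverseᴱ r)) ≡
                                 ∑[ j < deg (end z r) ] W (r ++ [ edge (end z r) j ])
      last-edge-reversed r = begin
        ∑[ i < deg y ] (𝟙 (end z r =ⱽ t (e i)) * w (e i ∷ reverseᴱ r))
          ≡⟨ sum-cong-≗ {deg y} (λ i →
               cong (λ b → 𝟙 b * w (e i ∷ reverseᴱ r)) (=ⱽ-sym (end z r) (t (e i)))) ⟩
        ∑[ i < deg y ] (𝟙 (t (e i) =ⱽ end z r) * w (e i ∷ reverseᴱ r))
          ≡⟨ ∑-edge-reverse y (end z r) (λ a → w (a ∷ reverseᴱ r)) ⟩
        ∑[ j < deg (end z r) ] (𝟙 (t (g j) =ⱽ y) * w (bar (g j) ∷ reverseᴱ r))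
          ≡⟨ sum-cong-≗ {deg (end z r)} (λ j → sym
               (cong₂ (λ v p → 𝟙 (v =ⱽ y) * w p) (end-snoc z r (g j)) (reverseᴱ-snoc r (g j)))) ⟩
        ∑[ j < deg (end z r) ] W (r ++ [ g j ]) ∎
        where
        g = edge (end z r)

    module AtVertex (x : V) where

      Σout : ℕ → (E → List E → ℕ) → ℕ
      Σout k K = ∑[ i < deg x ] Σpaths k (t (edge x i)) (K (edge x i))

      Σout-+ : ∀ k (K₁ K₂ : E → List E → ℕ) →
               Σout k (λ e p → K₁ e p + K₂ e p) ≡ Σout k K₁ + Σout k K₂
      Σout-+ k K₁ K₂ =
        trans (sum-cong-≗ {deg x} (λ i → Σpaths-+ k _ (K₁ (edge x i)) (K₂ (edge x i)))) (∑-distrib-+ {deg x} _ _)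

      tailed : E → List E → ℕ
      tailed e p = 𝟙 (end (t e) p =ⱽ t e) * 𝟙 (geodesic (e ∷ p ++ [ bar e ]))

      loops-split-by-tail : ∀ k → c (2 + k) x ≡ N (2 + k) x + Σout k tailed
      loops-split-by-tail k = begin
        c (2 + k) x
          ≡⟨ trans (c≡Σpaths (2 + k) x)
                   (sum-cong-≗ {deg x} (λ i → Σpaths-snoc k _ (𝟙 ∘ loop x ∘ (edge x i ∷_)))) ⟩
        Σout k (λ e p → ∑[ j < deg (end (t e) p) ] 𝟙 (loop x (e ∷ p ++ [ edge (end (t e) p) j ])))
          ≡⟨ sum-cong-≗ {deg x} (λ i → Σpaths-ext k _ (split (edge x i) (edge-o x i))) ⟩
        Σout k (λ e p → closedExtensions e p + tailed e p)
          ≡⟨ Σout-+ k closedExtensions tailed ⟩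
        Σout k closedExtensions + Σout k tailed
          ≡⟨ cong (_+ Σout k tailed) (sym (trans (N≡Σpaths (2 + k) x)
               (sum-cong-≗ {deg x} (λ i → Σpaths-snoc k _ (𝟙 ∘ closed x ∘ (edge x i ∷_)))))) ⟩
        N (2 + k) x + Σout k tailed ∎
        where
        closedExtensions : E → List E → ℕ
        closedExtensions e p = ∑[ j < deg (end (t e) p) ] 𝟙 (closed x (e ∷ p ++ [ edge (end (t e) p) j ]))

        split : ∀ e → o e ≡ x → ∀ p →
          ∑[ j < deg (end (t e) p) ] 𝟙 (loop x (e ∷ p ++ [ edge (end (t e) p) j ])) ≡
          closedExtensions e p + tailed e p
        split e oe≡x p = begin
          ∑[ j < deg z ] 𝟙 (L (g j))
            ≡⟨ sum-cong-≗ {deg z} (λ j → 𝟙-split (L (g j)) (g j =ᴱ bar e)) ⟩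
          ∑[ j < deg z ] (𝟙 (L (g j) ∧ not (g j =ᴱ bar e)) + 𝟙 (g j =ᴱ bar e) * 𝟙 (L (g j)))
            ≡⟨ ∑-distrib-+ {deg z} _ _ ⟩
          ∑[ j < deg z ] 𝟙 (L (g j) ∧ not (g j =ᴱ bar e)) + ∑[ j < deg z ] (𝟙 (g j =ᴱ bar e) * 𝟙 (L (g j)))
            ≡⟨ cong₂ _+_ (sum-cong-≗ {deg z} (λ j → cong (λ h → 𝟙 (L (g j) ∧ not (h =ᴱ bar e)))
                                                         (sym (last-snoc e p (g j)))))
                         (∑-edge-δ z (bar e) (𝟙 ∘ L)) ⟩
          closedExtensions e p + 𝟙 (o (bar e) =ⱽ z) * 𝟙 (L (bar e))
            ≡⟨ cong (closedExtensions e p +_) (cong₂ (λ b b′ → 𝟙 b * 𝟙 b′)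
                 (trans (cong (_=ⱽ z) (origin-bar e)) (=ⱽ-sym (t e) z))
                 (loop-snoc x (e ∷ p) (bar e) (trans (target-bar e) oe≡x))) ⟩
          closedExtensions e p + tailed e p ∎
          where
          z = end (t e) p
          g = edge z

          L : E → Bool
          L h = loop x (e ∷ p ++ [ h ])

      farLoop : E → List E → ℕ
      farLoop e p = 𝟙 (loop (t e) p)

      backtrackIn backtrackOut backtrackInOut : E → List E → ℕ
      backtrackIn    e p = 𝟙 (startsWith (bar e) p) * 𝟙 (loop (t e) p)
      backtrackOut   e p = 𝟙 (endsWith e p) * 𝟙 (loop (t e) p)
      backtrackInOut e p = 𝟙 (startsWith (bar e) p) * (𝟙 (endsWith e p) * 𝟙 (loop (t e) p))

      tailed-inclusion-exclusion : ∀ j →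
        Σout (suc j) farLoop + Σout (suc j) backtrackInOut ≡
        Σout (suc j) tailed + Σout (suc j) backtrackIn + Σout (suc j) backtrackOut
      tailed-inclusion-exclusion j = begin
        Σout (suc j) farLoop + Σout (suc j) backtrackInOut
          ≡⟨ sym (Σout-+ (suc j) farLoop backtrackInOut) ⟩
        Σout (suc j) (λ e p → farLoop e p + backtrackInOut e p)
          ≡⟨ sum-cong-≗ {deg x} (λ i → Σpaths-cong (suc j) _ (pointwise (edge x i))) ⟩
        Σout (suc j) (λ e p → tailed e p + backtrackIn e p + backtrackOut e p)
          ≡⟨ Σout-+ (suc j) (λ e p → tailed e p + backtrackIn e p) backtrackOut ⟩
        Σout (suc j) (λ e p → tailed e p + backtrackIn e p) + Σout (suc j) backtrackOut
          ≡⟨ cong (_+ Σout (suc j) backtrackOut) (Σout-+ (suc j) tailed backtrackIn) ⟩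
        Σout (suc j) tailed + Σout (suc j) backtrackIn + Σout (suc j) backtrackOut ∎
        where
        pointwise : ∀ e p → Path (suc j) (t e) p →
          farLoop e p + backtrackInOut e p ≡ tailed e p + backtrackIn e p + backtrackOut e p
        pointwise e (f ∷ q) _ = begin
          𝟙 (Geo ∧ En) + 𝟙 F * (𝟙 Z * 𝟙 (Geo ∧ En))
            ≡⟨ 𝟙-inclusion-exclusion Geo En F Z ⟩
          𝟙 En * 𝟙 (not F ∧ (Geo ∧ not Z)) + 𝟙 F * 𝟙 (Geo ∧ En) + 𝟙 Z * 𝟙 (Geo ∧ En)
            ≡⟨ cong (λ b → 𝟙 En * 𝟙 (not F ∧ b) + 𝟙 F * 𝟙 (Geo ∧ En) + 𝟙 Z * 𝟙 (Geo ∧ En))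
                    (sym exit) ⟩
          tailed e (f ∷ q) + backtrackIn e (f ∷ q) + backtrackOut e (f ∷ q) ∎
          where
          Geo = geodesic (f ∷ q)
          En  = end (t f) q =ⱽ t e
          F   = f =ᴱ bar e
          Z   = last f q =ᴱ e

          exit : geodesic (f ∷ q ++ [ bar e ]) ≡ Geo ∧ not Z
          exit = trans (geodesic-snoc (f ∷ q) (bar e)) (cong (λ a → Geo ∧ not (last f q =ᴱ a)) (bar-bar e))

      backtrackIn≡backtrackOut : ∀ k → Σout k backtrackIn ≡ Σout k backtrackOut
      backtrackIn≡backtrackOut k = sum-cong-≗ {deg x} (λ i → reversal (edge x i))
        where
        reversal : ∀ e → Σpaths k (t e) (backtrackIn e) ≡ Σpaths k (t e) (backtrackOut e)
        reversal e = begin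
          Σpaths k (t e) (backtrackIn e)
            ≡⟨ Σpaths-ext k (t e) (λ p → 𝟙-rotate (startsWith (bar e) p) (geodesic p) _) ⟩
          Σpaths k (t e) (λ p → 𝟙 (end (t e) p =ⱽ t e) * 𝟙 (startsWith (bar e) p ∧ geodesic p))
            ≡⟨ Σpaths-reverse k (t e) (t e) (λ p → 𝟙 (startsWith (bar e) p ∧ geodesic p)) ⟩
          Σpaths k (t e) (λ r → 𝟙 (end (t e) r =ⱽ t e) *
                                𝟙 (startsWith (bar e) (reverseᴱ r) ∧ geodesic (reverseᴱ r)))
            ≡⟨ Σpaths-ext k (t e) (λ r → cong₂ (λ a b → 𝟙 (end (t e) r =ⱽ t e) * 𝟙 (a ∧ b))
                 (trans (startsWith-reverseᴱ (bar e) r) (cong (λ a → endsWith a r) (bar-bar e)))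
                 (geodesic-reverseᴱ r)) ⟩
          Σpaths k (t e) (λ r → 𝟙 (end (t e) r =ⱽ t e) * 𝟙 (endsWith e r ∧ geodesic r))
            ≡⟨ Σpaths-ext k (t e) (λ r → sym (𝟙-rotate (endsWith e r) (geodesic r) _)) ⟩
          Σpaths k (t e) (backtrackOut e) ∎

      bracketed : E → List E → ℕ
      bracketed e w = 𝟙 (geodesic (bar e ∷ w ++ [ e ]) ∧ (end x w =ⱽ x))

      brackets : ℕ → ℕ
      brackets m = ∑[ i < deg x ] Σpaths m x (bracketed (edge x i))

      brackets-0 : brackets 0 ≡ 0
      brackets-0 =
        trans (sum-cong-≗ {deg x} (λ i → cong (λ b → 𝟙 ((not b ∧ true) ∧ (x =ⱽ x))) (turns-back (edge x i))))
              (sum-replicate-zero (deg x))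
        where
        turns-back : ∀ e → (e =ᴱ bar (bar e)) ≡ true
        turns-back e = dec-true (e ≟E bar (bar e)) (sym (bar-bar e))

      Σpaths-bracketed : ∀ m e → o e ≡ x →
        Σpaths m (t (bar e)) (λ w → 𝟙 (geodesic (bar e ∷ w ++ [ e ]) ∧ (end (t (bar e)) w =ⱽ x))) ≡
        Σpaths m x (bracketed e)
      Σpaths-bracketed m e oe≡x =
        cong (λ v → Σpaths m v (λ w → 𝟙 (geodesic (bar e ∷ w ++ [ e ]) ∧ (end v w =ⱽ x))))
             (trans (target-bar e) oe≡x)

      closing-edge : ∀ e v w p → o e ≡ x →
        𝟙 (o e =ⱽ end v w) * 𝟙 (loop (t e) (p ++ [ e ])) ≡ 𝟙 (geodesic (p ++ [ e ]) ∧ (end v w =ⱽ x))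
      closing-edge e v w p oe≡x = begin
        𝟙 (o e =ⱽ end v w) * 𝟙 (loop (t e) (p ++ [ e ]))
          ≡⟨ cong₂ (λ a b → 𝟙 a * 𝟙 b) (trans (cong (_=ⱽ end v w) oe≡x) (=ⱽ-sym x (end v w)))
                                        (loop-snoc (t e) p e refl) ⟩
        𝟙 (end v w =ⱽ x) * 𝟙 (geodesic (p ++ [ e ]))
          ≡⟨ 𝟙-*-𝟙 (end v w =ⱽ x) (geodesic (p ++ [ e ])) ⟩
        𝟙 (geodesic (p ++ [ e ]) ∧ (end v w =ⱽ x)) ∎

      rotatedGeodesic : List E → ℕ
      rotatedGeodesic r = 𝟙 (geodesic (rotate r) ∧ (end x r =ⱽ x))

      backtrackOut≡rotatedGeodesics : ∀ j → Σout (suc j) backtrackOut ≡ Σpaths (suc j) x rotatedGeodesic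
      backtrackOut≡rotatedGeodesics j = sum-cong-≗ {deg x} (λ i → rotation (edge x i) (edge-o x i))
        where
        rotation : ∀ e → o e ≡ x →
          Σpaths (suc j) (t e) (backtrackOut e) ≡ Σpaths j (t e) (λ q → rotatedGeodesic (e ∷ q))
        rotation e oe≡x = trans (Σpaths-last j (t e) e (𝟙 ∘ loop (t e)))
                                (Σpaths-ext j (t e) (λ q → closing-edge e (t e) q q oe≡x))

      rotatedGeodesics : ∀ j → Σpaths (suc j) x rotatedGeodesic ≡ N (suc j) x + brackets (j ∸ 1)
      rotatedGeodesics zero = begin
        Σpaths 1 x rotatedGeodesic ≡⟨ sum-cong-≗ {deg x} (λ i → no-tail (edge x i)) ⟩
        Σpaths 1 x (𝟙 ∘ closed x)  ≡⟨ sym (N≡Σpaths 1 x) ⟩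
        N 1 x                      ≡⟨ sym (+-identityʳ _) ⟩
        N 1 x + 0                  ≡⟨ cong (N 1 x +_) (sym brackets-0) ⟩
        N 1 x + brackets 0         ∎
        where
        no-tail : ∀ e → rotatedGeodesic [ e ] ≡ 𝟙 (closed x [ e ])
        no-tail e = cong 𝟙 (sym (trans (cong (λ b → (t e =ⱽ x) ∧ not b) (=ᴱ-bar-self e)) (∧-identityʳ _)))
      rotatedGeodesics (suc m) = begin
        Σpaths (2 + m) x rotatedGeodesic
          ≡⟨ Σpaths-cong (2 + m) x split ⟩
        Σpaths (2 + m) x (λ r → 𝟙 (closed x r) + backtrackStart r)
          ≡⟨ Σpaths-+ (2 + m) x (𝟙 ∘ closed x) backtrackStart ⟩
        Σpaths (2 + m) x (𝟙 ∘ closed x) + Σpaths (2 + m) x backtrackStart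
          ≡⟨ cong₂ _+_ (sym (N≡Σpaths (2 + m) x))
                       (sum-cong-≗ {deg x} (λ i → bracketing (edge x i) (edge-o x i))) ⟩
        N (2 + m) x + brackets m ∎
        where
        backtrackStart : List E → ℕ
        backtrackStart []      = 0
        backtrackStart (e ∷ p) = 𝟙 (startsWith (bar e) p) * rotatedGeodesic (e ∷ p)

        split : ∀ r → Path (2 + m) x r → rotatedGeodesic r ≡ 𝟙 (closed x r) + backtrackStart r
        split (e ∷ f ∷ w) _ = trans (𝟙-split _ F) (cong (λ a → 𝟙 a + backtrackStart (e ∷ f ∷ w)) (begin
          (geodesic (f ∷ w ++ [ e ]) ∧ En) ∧ not F
            ≡⟨ cong (λ a → (a ∧ En) ∧ not F) (geodesic-snoc (f ∷ w) e) ⟩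
          ((Geo ∧ not Z) ∧ En) ∧ not F
            ≡⟨ ∧-Solver.solve 4 (λ g z n f → ((g ⊕ z) ⊕ n) ⊕ f ⊜ ((f ⊕ g) ⊕ n) ⊕ z)
                                refl Geo (not Z) En (not F) ⟩
          closed x (e ∷ f ∷ w) ∎))
          where
          Geo = geodesic (f ∷ w)
          En  = end (t f) w =ⱽ x
          F   = f =ᴱ bar e
          Z   = last f w =ᴱ bar e

        bracketing : ∀ e → o e ≡ x →
          Σpaths (suc m) (t e) (λ p → 𝟙 (startsWith (bar e) p) * rotatedGeodesic (e ∷ p)) ≡ Σpaths m x (bracketed e)
        bracketing e oe≡x = trans (Σpaths-first m (t e) (bar e) (rotatedGeodesic ∘ (e ∷_)) (origin-bar e))
                                  (Σpaths-bracketed m e oe≡x)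

      backtrackInOut-count : ∀ j → Σout (suc j) backtrackInOut ≡ brackets (j ∸ 1)
      backtrackInOut-count zero = begin
        Σout 1 backtrackInOut ≡⟨ sum-cong-≗ {deg x} (λ i → impossible (edge x i)) ⟩
        ∑[ i < deg x ] 0      ≡⟨ sum-replicate-zero (deg x) ⟩
        0                     ≡⟨ sym brackets-0 ⟩
        brackets 0            ∎
        where
        impossible : ∀ e → Σpaths 1 (t e) (backtrackInOut e) ≡ 0
        impossible e = trans (Σpaths-first 0 (t e) (bar e) (λ p → 𝟙 (endsWith e p) * 𝟙 (loop (t e) p)) (origin-bar e))
                             (cong (λ b → 𝟙 b * 𝟙 (loop (t e) [ bar e ])) (bar-=ᴱ-self e))
      backtrackInOut-count (suc m) = sum-cong-≗ {deg x} (λ i → bracketing (edge x i) (edge-o x i))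
        where
        bracketing : ∀ e → o e ≡ x → Σpaths (2 + m) (t e) (backtrackInOut e) ≡ Σpaths m x (bracketed e)
        bracketing e oe≡x = begin
          Σpaths (2 + m) (t e) (backtrackInOut e)
            ≡⟨ Σpaths-first (suc m) (t e) (bar e) (λ p → 𝟙 (endsWith e p) * 𝟙 (loop (t e) p)) (origin-bar e) ⟩
          Σpaths (suc m) (t (bar e)) (λ q → 𝟙 (endsWith e (bar e ∷ q)) * 𝟙 (loop (t e) (bar e ∷ q)))
            ≡⟨ Σpaths-cong (suc m) (t (bar e)) nonempty ⟩
          Σpaths (suc m) (t (bar e)) (λ q → 𝟙 (endsWith e q) * 𝟙 (loop (t e) (bar e ∷ q)))
            ≡⟨ Σpaths-last m (t (bar e)) e (λ q → 𝟙 (loop (t e) (bar e ∷ q))) ⟩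
          Σpaths m (t (bar e)) (λ w → 𝟙 (o e =ⱽ end (t (bar e)) w) * 𝟙 (loop (t e) (bar e ∷ w ++ [ e ])))
            ≡⟨ Σpaths-ext m (t (bar e)) (λ w → closing-edge e (t (bar e)) w (bar e ∷ w) oe≡x) ⟩
          Σpaths m (t (bar e)) (λ w → 𝟙 (geodesic (bar e ∷ w ++ [ e ]) ∧ (end (t (bar e)) w =ⱽ x)))
            ≡⟨ Σpaths-bracketed m e oe≡x ⟩
          Σpaths m x (bracketed e) ∎
          where
          nonempty : ∀ q → Path (suc m) (t (bar e)) q →
            𝟙 (endsWith e (bar e ∷ q)) * 𝟙 (loop (t e) (bar e ∷ q)) ≡
            𝟙 (endsWith e q) * 𝟙 (loop (t e) (bar e ∷ q))
          nonempty (f ∷ q) _ = refl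

      brackets-count : ∀ n → brackets (suc n) + N (suc n) x + c (suc n) x ≡ deg x * c (suc n) x
      brackets-count n = begin
        brackets (suc n) + N (suc n) x + c (suc n) x
          ≡⟨ cong₂ (λ u v → u + v + c (suc n) x) (sym (Σpaths-∑ (suc n) x (deg x) (bracketed ∘ edge x)))
                                                   (N≡Σpaths (suc n) x) ⟩
        Σpaths (suc n) x allBrackets + Σpaths (suc n) x (𝟙 ∘ closed x) + c (suc n) x
          ≡⟨ cong₂ _+_ (sym (Σpaths-+ (suc n) x allBrackets (𝟙 ∘ closed x))) (c≡Σpaths (suc n) x) ⟩
        Σpaths (suc n) x (λ w → allBrackets w + 𝟙 (closed x w)) + Σpaths (suc n) x (𝟙 ∘ loop x)
          ≡⟨ sym (Σpaths-+ (suc n) x (λ w → allBrackets w + 𝟙 (closed x w)) (𝟙 ∘ loop x)) ⟩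
        Σpaths (suc n) x (λ w → allBrackets w + 𝟙 (closed x w) + 𝟙 (loop x w))
          ≡⟨ Σpaths-cong (suc n) x pointwise ⟩
        Σpaths (suc n) x (λ w → deg x * 𝟙 (loop x w))
          ≡⟨ Σpaths-* (suc n) x (deg x) (𝟙 ∘ loop x) ⟩
        deg x * Σpaths (suc n) x (𝟙 ∘ loop x)
          ≡⟨ cong (deg x *_) (sym (c≡Σpaths (suc n) x)) ⟩
        deg x * c (suc n) x ∎
        where
        allBrackets : List E → ℕ
        allBrackets w = ∑[ i < deg x ] bracketed (edge x i) w

        count-if-loop : ∀ l q X → (l ≡ true → X + 𝟙 (not q) + 1 ≡ deg x) →
                        𝟙 l * X + 𝟙 (l ∧ not q) + 𝟙 l ≡ deg x * 𝟙 l
        count-if-loop true  q X h =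
          trans (cong (λ u → u + 𝟙 (not q) + 1) (*-identityˡ X)) (trans (h refl) (sym (*-identityʳ _)))
        count-if-loop false q X h = sym (*-zeroʳ (deg x))

        pointwise : ∀ w → Path (suc n) x w →
          allBrackets w + 𝟙 (closed x w) + 𝟙 (loop x w) ≡ deg x * 𝟙 (loop x w)
        pointwise (a ∷ w′) (_ , cons oa≡x _) = begin
          allBrackets (a ∷ w′) + 𝟙 (closed x (a ∷ w′)) + 𝟙 L
            ≡⟨ cong₂ (λ u v → u + 𝟙 (L ∧ not v) + 𝟙 L) factor (=ᴱ-bar (last a w′) a) ⟩
          𝟙 L * avoiding + 𝟙 (L ∧ not (a =ᴱ b)) + 𝟙 L
            ≡⟨ count-if-loop L (a =ᴱ b) avoiding (λ l → ∑-avoiding-two x a b oa≡x (ob≡x l)) ⟩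
          deg x * 𝟙 L ∎
          where
          L = loop x (a ∷ w′)
          b = bar (last a w′)

          Avoids : E → Bool
          Avoids e = not (e =ᴱ a) ∧ not (e =ᴱ b)

          avoiding : ℕ
          avoiding = ∑[ i < deg x ] 𝟙 (Avoids (edge x i))

          ob≡x : L ≡ true → o b ≡ x
          ob≡x l with end (t a) w′ ≟V x
          ... | yes end≡x = trans (origin-bar (last a w′)) (trans (sym (end≡t-last a w′)) end≡x)
          ... | no _      = contradiction (trans (sym (∧-zeroʳ _)) l) (λ ())

          factor : allBrackets (a ∷ w′) ≡ 𝟙 L * avoiding
          factor = trans (sum-cong-≗ {deg x} (λ i → bracket (edge x i)))
                         (sym (*-distribˡ-sum (𝟙 L) (𝟙 ∘ Avoids ∘ edge x)))
            where
            Geo = geodesic (a ∷ w′)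
            En  = end (t a) w′ =ⱽ x

            bracket : ∀ e → bracketed e (a ∷ w′) ≡ 𝟙 L * 𝟙 (Avoids e)
            bracket e = begin
              𝟙 ((not (a =ᴱ bar (bar e)) ∧ geodesic (a ∷ w′ ++ [ e ])) ∧ En)
                ≡⟨ cong₂ (λ u v → 𝟙 ((not u ∧ v) ∧ En))
                     (trans (cong (a =ᴱ_) (bar-bar e)) (=ᴱ-sym a e))
                     (trans (geodesic-snoc (a ∷ w′) e) (cong (λ u → Geo ∧ not u) (=ᴱ-bar (last a w′) e))) ⟩
              𝟙 ((not (e =ᴱ a) ∧ (Geo ∧ not (e =ᴱ b))) ∧ En)
                ≡⟨ cong 𝟙 (∧-Solver.solve 4 (λ p g q n → (p ⊕ (g ⊕ q)) ⊕ n ⊜ (p ⊕ q) ⊕ (g ⊕ n))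
                                            refl (not (e =ᴱ a)) Geo (not (e =ᴱ b)) En) ⟩
              𝟙 (Avoids e ∧ L)
                ≡⟨ sym (𝟙-*-𝟙 L (Avoids e)) ⟩
              𝟙 L * 𝟙 (Avoids e) ∎

      neighbourLoops : ℕ → ℕ
      neighbourLoops k = ∑[ i < deg x ] c k (t (edge x i))

      -- For j = 0 the truncated index gives brackets 0, which vanishes by brackets-0.
      loops-recurrence : ∀ j →
        neighbourLoops (suc j) + N (3 + j) x ≡ c (3 + j) x + (N (suc j) x + N (suc j) x) + brackets (j ∸ 1)
      loops-recurrence j = +-cancelʳ-≡ β _ _ (begin
        S + N′ + β                   ≡⟨ solve 3 (λ s n b → s :+ n :+ b := s :+ b :+ n) refl S N′ β ⟩
        S + β + N′                   ≡⟨ cong (λ u → S + u + N′) (sym (backtrackInOut-count j)) ⟩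
        S + InOut + N′               ≡⟨ cong (_+ N′) (trans (cong (_+ InOut) farLoops)
                                                             (tailed-inclusion-exclusion j)) ⟩
        T + In + Out + N′            ≡⟨ cong (λ u → T + u + Out + N′) (backtrackIn≡backtrackOut (suc j)) ⟩
        T + Out + Out + N′           ≡⟨ cong (λ u → T + u + u + N′) outs ⟩
        T + (Nj + β) + (Nj + β) + N′ ≡⟨ solve 4 (λ t n b n′ → t :+ (n :+ b) :+ (n :+ b) :+ n′ :=
                                                                n′ :+ t :+ (n :+ n) :+ b :+ b) refl T Nj β N′ ⟩
        N′ + T + (Nj + Nj) + β + β   ≡⟨ cong (λ u → u + (Nj + Nj) + β + β) (sym (loops-split-by-tail (suc j))) ⟩
        c (3 + j) x + (Nj + Nj) + β + β ∎)
        where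
        β     = brackets (j ∸ 1)
        S     = neighbourLoops (suc j)
        N′    = N (3 + j) x
        Nj    = N (suc j) x
        T     = Σout (suc j) tailed
        In    = Σout (suc j) backtrackIn
        Out   = Σout (suc j) backtrackOut
        InOut = Σout (suc j) backtrackInOut

        farLoops : S ≡ Σout (suc j) farLoop
        farLoops = sum-cong-≗ {deg x} (λ i → c≡Σpaths (suc j) (t (edge x i)))

        outs : Out ≡ Nj + β
        outs = trans (backtrackOut≡rotatedGeodesics j) (rotatedGeodesics j)

      closedGeodesics-1 : N 1 x ≡ c 1 x
      closedGeodesics-1 = trans (N≡Σpaths 1 x) (trans (Σpaths-cong 1 x no-tail) (sym (c≡Σpaths 1 x)))
        where
        no-tail : ∀ p → Path 1 x p → 𝟙 (closed x p) ≡ 𝟙 (loop x p)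
        no-tail (e ∷ []) _ = cong 𝟙 (trans (cong (λ b → loop x [ e ] ∧ not b) (=ᴱ-bar-self e)) (∧-identityʳ _))

      closedGeodesics-2 : N 2 x ≡ c 2 x
      closedGeodesics-2 = trans (N≡Σpaths 2 x) (trans (Σpaths-cong 2 x no-tail) (sym (c≡Σpaths 2 x)))
        where
        no-tail : ∀ p → Path 2 x p → 𝟙 (closed x p) ≡ 𝟙 (loop x p)
        no-tail (e ∷ f ∷ []) _ with f =ᴱ bar e
        ... | true  = refl
        ... | false = cong 𝟙 (∧-identityʳ _)

module ClosedGeodesicFormula (G : Graph) (_≟V_ : DecidableEquality (Graph.V G)) (x : Graph.V G) where

  open import Data.Nat as ℕ using (ℕ; zero; suc; _∸_)
  import Data.Nat.Properties as ℕ
  open import Algebra.Properties.Semiring.Sum ℕ.+-*-semiring using (sum-syntax)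
  open import Data.Integer using (ℤ; +_; _+_; _-_; _*_)
  open import Data.Integer.Properties using (pos-+; pos-*)
  open import Data.Integer.Solver using (module +-*-Solver)
  open +-*-Solver using (solve; _:+_; _:-_; _:*_; _:=_; con)
  open import Data.Fin as Fin using (Fin)
  open import Function using (_∘_)
  open import Relation.Binary.PropositionalEquality
  open ≡-Reasoning
  open Graph G using (deg; edge; t)
  open Counting G _≟V_ using (c; N; Δc; sumFin)
  open PathSums.OnGraph.AtVertex G _≟V_ x
    using (neighbourLoops; brackets; brackets-0; brackets-count; loops-recurrence; closedGeodesics-1; closedGeodesics-2)

  d : ℤ
  d = + deg x

  cℤ Nℤ Δ : ℕ → ℤ
  cℤ k = + c k x
  Nℤ k = + N k x
  Δ  k = Δc k x

  sumFin-pos : ∀ n (f : Fin n → ℕ) → sumFin n (λ i → + f i) ≡ + ∑[ i < n ] f i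
  sumFin-pos zero    f = refl
  sumFin-pos (suc n) f = trans (cong (_+_ (+ f Fin.zero)) (sumFin-pos n (f ∘ Fin.suc))) (sym (pos-+ (f Fin.zero) _))

  neighbourLoops≡ : ∀ k → + neighbourLoops k ≡ d * cℤ k - Δ k
  neighbourLoops≡ k = begin
    + neighbourLoops k
      ≡⟨ solve 2 (λ s a → s := a :- (a :- s)) refl (+ neighbourLoops k) (d * cℤ k) ⟩
    d * cℤ k - (d * cℤ k - + neighbourLoops k)
      ≡⟨ cong (λ s → d * cℤ k - (d * cℤ k - s)) (sym (sumFin-pos (deg x) (λ i → c k (t (edge x i))))) ⟩
    d * cℤ k - Δ k ∎

  brackets≡ : ∀ n → + brackets (suc n) ≡ d * cℤ (suc n) - Nℤ (suc n) - cℤ (suc n)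
  brackets≡ n = begin
    + B
      ≡⟨ solve 3 (λ b n c → b := b :+ n :+ c :- n :- c) refl (+ B) (Nℤ (suc n)) (cℤ (suc n)) ⟩
    + B + Nℤ (suc n) + cℤ (suc n) - Nℤ (suc n) - cℤ (suc n)
      ≡⟨ cong (λ u → u - Nℤ (suc n) - cℤ (suc n)) counted ⟩
    d * cℤ (suc n) - Nℤ (suc n) - cℤ (suc n) ∎
    where
    B = brackets (suc n)

    counted : + B + Nℤ (suc n) + cℤ (suc n) ≡ d * cℤ (suc n)
    counted = begin
      + B + Nℤ (suc n) + cℤ (suc n)          ≡⟨ cong (_+ cℤ (suc n)) (sym (pos-+ B _)) ⟩
      + (B ℕ.+ N (suc n) x) + cℤ (suc n)     ≡⟨ sym (pos-+ (B ℕ.+ N (suc n) x) _) ⟩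
      + (B ℕ.+ N (suc n) x ℕ.+ c (suc n) x) ≡⟨ cong +_ (brackets-count n) ⟩
      + (deg x ℕ.* c (suc n) x)              ≡⟨ pos-* (deg x) _ ⟩
      d * cℤ (suc n)                         ∎

  excess : ℕ → ℤ
  excess j = Nℤ (2 ℕ.+ j) - cℤ (2 ℕ.+ j) - (Nℤ j - cℤ j) + (d - + 2) * cℤ j

  excess-recurrence : ∀ j → excess (suc j) ≡ Δ (suc j) + (Nℤ (suc j) - cℤ (suc j) + + brackets (j ∸ 1))
  excess-recurrence j = begin
    excess (suc j)
      ≡⟨ cong (λ n → n - cℤ (3 ℕ.+ j) - (Nℤ (suc j) - cℤ (suc j)) + (d - + 2) * cℤ (suc j)) N-next ⟩
    cℤ (3 ℕ.+ j) + (Nℤ (suc j) + Nℤ (suc j)) + + β - (d * cℤ (suc j) - Δ (suc j))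
      - cℤ (3 ℕ.+ j) - (Nℤ (suc j) - cℤ (suc j)) + (d - + 2) * cℤ (suc j)
      ≡⟨ solve 6 (λ c₃ n₁ b D c₁ δ →
           c₃ :+ (n₁ :+ n₁) :+ b :- (D :* c₁ :- δ) :- c₃ :- (n₁ :- c₁) :+ (D :- con (+ 2)) :* c₁
           := δ :+ (n₁ :- c₁ :+ b))
           refl (cℤ (3 ℕ.+ j)) (Nℤ (suc j)) (+ β) d (cℤ (suc j)) (Δ (suc j)) ⟩
    Δ (suc j) + (Nℤ (suc j) - cℤ (suc j) + + β) ∎
    where
    β = brackets (j ∸ 1)
    S = neighbourLoops (suc j)

    recurrence : + S + Nℤ (3 ℕ.+ j) ≡ cℤ (3 ℕ.+ j) + (Nℤ (suc j) + Nℤ (suc j)) + + β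
    recurrence = begin
      + S + Nℤ (3 ℕ.+ j)
        ≡⟨ sym (pos-+ S _) ⟩
      + (S ℕ.+ N (3 ℕ.+ j) x)
        ≡⟨ cong +_ (loops-recurrence j) ⟩
      + (c (3 ℕ.+ j) x ℕ.+ (N (suc j) x ℕ.+ N (suc j) x) ℕ.+ β)
        ≡⟨ pos-+ _ β ⟩
      + (c (3 ℕ.+ j) x ℕ.+ (N (suc j) x ℕ.+ N (suc j) x)) + + β
        ≡⟨ cong (_+ + β) (pos-+ (c (3 ℕ.+ j) x) _) ⟩
      cℤ (3 ℕ.+ j) + + (N (suc j) x ℕ.+ N (suc j) x) + + β
        ≡⟨ cong (λ u → cℤ (3 ℕ.+ j) + u + + β) (pos-+ (N (suc j) x) _) ⟩
      cℤ (3 ℕ.+ j) + (Nℤ (suc j) + Nℤ (suc j)) + + β ∎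

    N-next : Nℤ (3 ℕ.+ j) ≡ cℤ (3 ℕ.+ j) + (Nℤ (suc j) + Nℤ (suc j)) + + β - (d * cℤ (suc j) - Δ (suc j))
    N-next = begin
      Nℤ (3 ℕ.+ j)             ≡⟨ solve 2 (λ s n → n := s :+ n :- s) refl (+ S) (Nℤ (3 ℕ.+ j)) ⟩
      + S + Nℤ (3 ℕ.+ j) - + S ≡⟨ cong₂ _-_ recurrence (neighbourLoops≡ (suc j)) ⟩
      cℤ (3 ℕ.+ j) + (Nℤ (suc j) + Nℤ (suc j)) + + β - (d * cℤ (suc j) - Δ (suc j)) ∎

  excess-base : ∀ j → N (suc j) x ≡ c (suc j) x → brackets (j ∸ 1) ≡ 0 → excess (suc j) ≡ + 0 + Δ (suc j)
  excess-base j N≡c B≡0 = begin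
    excess (suc j)
      ≡⟨ excess-recurrence j ⟩
    Δ (suc j) + (Nℤ (suc j) - cℤ (suc j) + + brackets (j ∸ 1))
      ≡⟨ cong₂ (λ n b → Δ (suc j) + (+ n - cℤ (suc j) + + b)) N≡c B≡0 ⟩
    Δ (suc j) + (cℤ (suc j) - cℤ (suc j) + + 0)
      ≡⟨ solve 2 (λ δ c → δ :+ (c :- c :+ con (+ 0)) := con (+ 0) :+ δ) refl (Δ (suc j)) (cℤ (suc j)) ⟩
    + 0 + Δ (suc j) ∎

  sum1to-cong : ∀ n {f g : ℕ → ℤ} → (∀ i → f i ≡ g i) → sum1to n f ≡ sum1to n g
  sum1to-cong zero    f≗g = refl
  sum1to-cong (suc n) f≗g = cong₂ _+_ (sum1to-cong n f≗g) (f≗g (suc n))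

  sum1to-+ : ∀ n (f g : ℕ → ℤ) → sum1to n (λ i → f i + g i) ≡ sum1to n f + sum1to n g
  sum1to-+ zero    f g = refl
  sum1to-+ (suc n) f g = trans (cong (_+ (f (suc n) + g (suc n))) (sum1to-+ n f g))
    (solve 4 (λ a b c d → (a :+ b) :+ (c :+ d) := (a :+ c) :+ (b :+ d)) refl
             (sum1to n f) (sum1to n g) (f (suc n)) (g (suc n)))

  sum1to-shift : ∀ n (f : ℕ → ℤ) → sum1to (suc n) f ≡ f 1 + sum1to n (f ∘ suc)
  sum1to-shift zero    f = solve 1 (λ a → con (+ 0) :+ a := a :+ con (+ 0)) refl (f 1)
  sum1to-shift (suc n) f = trans (cong (_+ f (2 ℕ.+ n)) (sum1to-shift n f))
    (solve 3 (λ a b c → (a :+ b) :+ c := a :+ (b :+ c)) refl (f 1) (sum1to n (f ∘ suc)) (f (2 ℕ.+ n)))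

  -- upper (3 + m) is definitionally suc (upper (1 + m)).
  sum1to-alternating-step : ∀ m (g : ℕ → ℕ → ℤ) →
    sum1to (upper (3 ℕ.+ m)) (λ i → g i (3 ℕ.+ m ∸ 2 ℕ.* i)) ≡
    g 1 (suc m) + sum1to (upper (suc m)) (λ i → g (suc i) (suc m ∸ 2 ℕ.* i))
  sum1to-alternating-step m g = trans (sum1to-shift (upper (suc m)) _)
    (cong (_+_ (g 1 (suc m))) (sum1to-cong (upper (suc m)) (λ i →
      cong (λ k → g (suc i) (3 ℕ.+ m ∸ k)) (ℕ.*-suc 2 i))))

  Csum Dsum Isum formula : ℕ → ℤ
  Csum m = sum1to (upper m) (λ i → cℤ (m ∸ 2 ℕ.* i))
  Dsum m = sum1to (upper m) (λ i → Δ (m ∸ 2 ℕ.* i))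
  Isum m = sum1to (upper m) (λ i → + i * Δ (m ∸ 2 ℕ.* i))
  formula m = (cℤ m - (d - + 2) * Csum m) + Isum m

  Isum-step : ∀ m → Isum (3 ℕ.+ m) ≡ Dsum (3 ℕ.+ m) + Isum (suc m)
  Isum-step m = begin
    Isum (3 ℕ.+ m)
      ≡⟨ sum1to-alternating-step m (λ i k → + i * Δ k) ⟩
    + 1 * Δ (suc m) + sum1to (upper (suc m)) (λ i → + suc i * Δ (suc m ∸ 2 ℕ.* i))
      ≡⟨ cong (_+_ (+ 1 * Δ (suc m))) (sum1to-cong (upper (suc m)) (λ i →
           solve 2 (λ p a → (con (+ 1) :+ p) :* a := a :+ p :* a) refl (+ i) (Δ (suc m ∸ 2 ℕ.* i)))) ⟩
    + 1 * Δ (suc m) + sum1to (upper (suc m)) (λ i → Δ (suc m ∸ 2 ℕ.* i) + + i * Δ (suc m ∸ 2 ℕ.* i))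
      ≡⟨ cong (_+_ (+ 1 * Δ (suc m))) (sum1to-+ (upper (suc m)) _ _) ⟩
    + 1 * Δ (suc m) + (Dsum (suc m) + Isum (suc m))
      ≡⟨ solve 3 (λ a b c → con (+ 1) :* a :+ (b :+ c) := (a :+ b) :+ c)
                 refl (Δ (suc m)) (Dsum (suc m)) (Isum (suc m)) ⟩
    (Δ (suc m) + Dsum (suc m)) + Isum (suc m)
      ≡⟨ cong (_+ Isum (suc m)) (sym (sum1to-alternating-step m (λ _ k → Δ k))) ⟩
    Dsum (3 ℕ.+ m) + Isum (suc m) ∎

  excess≡Dsum : ∀ j → excess (suc j) ≡ Dsum (3 ℕ.+ j)
  excess≡Dsum zero          = excess-base 0 closedGeodesics-1 brackets-0
  excess≡Dsum (suc zero)    = excess-base 1 closedGeodesics-2 brackets-0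
  excess≡Dsum (suc (suc m)) = begin
    excess (3 ℕ.+ m)
      ≡⟨ excess-recurrence (2 ℕ.+ m) ⟩
    Δ (3 ℕ.+ m) + (Nℤ (3 ℕ.+ m) - cℤ (3 ℕ.+ m) + + brackets (suc m))
      ≡⟨ cong (λ b → Δ (3 ℕ.+ m) + (Nℤ (3 ℕ.+ m) - cℤ (3 ℕ.+ m) + b)) (brackets≡ m) ⟩
    Δ (3 ℕ.+ m) + (Nℤ (3 ℕ.+ m) - cℤ (3 ℕ.+ m) + (d * cℤ (suc m) - Nℤ (suc m) - cℤ (suc m)))
      ≡⟨ cong (_+_ (Δ (3 ℕ.+ m))) (solve 5 (λ n₃ c₃ D c₁ n₁ →
           n₃ :- c₃ :+ (D :* c₁ :- n₁ :- c₁) := n₃ :- c₃ :- (n₁ :- c₁) :+ (D :- con (+ 2)) :* c₁)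
           refl (Nℤ (3 ℕ.+ m)) (cℤ (3 ℕ.+ m)) d (cℤ (suc m)) (Nℤ (suc m))) ⟩
    Δ (3 ℕ.+ m) + excess (suc m)
      ≡⟨ cong (_+_ (Δ (3 ℕ.+ m))) (excess≡Dsum m) ⟩
    Δ (3 ℕ.+ m) + Dsum (3 ℕ.+ m)
      ≡⟨ sym (sum1to-alternating-step (2 ℕ.+ m) (λ _ k → Δ k)) ⟩
    Dsum (5 ℕ.+ m) ∎

  closedGeodesics≡formula : ∀ j → Nℤ (suc j) ≡ formula (suc j)
  closedGeodesics≡formula zero = trans (cong +_ closedGeodesics-1)
    (solve 2 (λ c D → c := (c :- (D :- con (+ 2)) :* con (+ 0)) :+ con (+ 0)) refl (cℤ 1) d)
  closedGeodesics≡formula (suc zero) = trans (cong +_ closedGeodesics-2)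
    (solve 2 (λ c D → c := (c :- (D :- con (+ 2)) :* con (+ 0)) :+ con (+ 0)) refl (cℤ 2) d)
  closedGeodesics≡formula (suc (suc m)) = begin
    Nℤ (3 ℕ.+ m)
      ≡⟨ solve 5 (λ n₃ n₁ c₃ c₁ D → n₃ := c₃ :+ (n₁ :- c₁) :- (D :- con (+ 2)) :* c₁
                                        :+ (n₃ :- c₃ :- (n₁ :- c₁) :+ (D :- con (+ 2)) :* c₁))
           refl (Nℤ (3 ℕ.+ m)) (Nℤ (suc m)) (cℤ (3 ℕ.+ m)) (cℤ (suc m)) d ⟩
    cℤ (3 ℕ.+ m) + (Nℤ (suc m) - cℤ (suc m)) - (d - + 2) * cℤ (suc m) + excess (suc m)
      ≡⟨ cong₂ (λ n e → cℤ (3 ℕ.+ m) + (n - cℤ (suc m)) - (d - + 2) * cℤ (suc m) + e)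
               (closedGeodesics≡formula m) (excess≡Dsum m) ⟩
    cℤ (3 ℕ.+ m) + (formula (suc m) - cℤ (suc m)) - (d - + 2) * cℤ (suc m) + Dsum (3 ℕ.+ m)
      ≡⟨ solve 6 (λ c₃ c₁ D cs is ds →
           c₃ :+ ((c₁ :- (D :- con (+ 2)) :* cs) :+ is :- c₁) :- (D :- con (+ 2)) :* c₁ :+ ds
           := (c₃ :- (D :- con (+ 2)) :* (c₁ :+ cs)) :+ (ds :+ is))
           refl (cℤ (3 ℕ.+ m)) (cℤ (suc m)) d (Csum (suc m)) (Isum (suc m)) (Dsum (3 ℕ.+ m)) ⟩
    (cℤ (3 ℕ.+ m) - (d - + 2) * (cℤ (suc m) + Csum (suc m))) + (Dsum (3 ℕ.+ m) + Isum (suc m))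
      ≡⟨ cong₂ (λ u v → (cℤ (3 ℕ.+ m) - (d - + 2) * u) + v)
               (sym (sum1to-alternating-step m (λ _ k → cℤ k))) (sym (Isum-step m)) ⟩
    formula (3 ℕ.+ m) ∎

open import Data.Nat using (ℕ; _>_; s≤s)
open import Data.Integer using (ℤ; +_; _+_; _-_; _*_)
open import Relation.Binary.PropositionalEquality using (_≡_)

proposition3p2 :
    (G : Graph) → Connected G → (cnt : Countable G) → BoundedDegree G → NoDegreeOne G →
      (x₀ : Graph.V G) → (m : ℕ) → m > 2 →
      let open Counting G (decV G cnt) in
      + N m x₀ ≡
        (+ c m x₀
          - (+ Graph.deg G x₀ - + 2) * sum1to (upper m) (λ i → + c (m Data.Nat.∸ (2 Data.Nat.* i)) x₀))
          + sum1to (upper m) (λ i → + i * Δc (m Data.Nat.∸ (2 Data.Nat.* i)) x₀)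
proposition3p2 G _ cnt _ _ x₀ _ (s≤s (s≤s (s≤s {n = k} _))) =
  ClosedGeodesicFormula.closedGeodesics≡formula G (decV G cnt) x₀ (2 Data.Nat.+ k)
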